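{- Let $G$ be a finite simple $(P_2\cup P_4,\ \text{diamond})$-free graph with $\omega(G)=3$. Let $A$ be a maximum clique of $G$, let $H=G-A$ be nonempty, and let $k=\omega(H)$. If $k\le 2$, then $\chi(G)\le 6$.
   Context: $P_2\cup P_4$ is the disjoint union of a path on 2 vertices and a path on 4 vertices; the diamond is $K_4$ minus one edge; $H$-free means no induced subgraph isomorphic to $H$. $\chi$ and $\omega$ denote chromatic number and clique number; $G-A$ is the graph obtained by deleting the vertices of $A$. -}

module Defs where

open import Data.Nat using (ℕ; _≤_; _>_)
open import Data.Bool using (Bool; true; false)
open import Data.Fin using (Fin; zero; suc)
open import Data.Fin.Subset using (Subset; _∈_; ∣_∣; ∁; ⊤)
open import Data.Product using (Σ; ∃; _×_)
open import Relation.Nullary using (¬_)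
open import Relation.Binary.PropositionalEquality using (_≡_; _≢_)
open import Function.Definitions using (Injective)

record Graph (n : ℕ) : Set where
  field
    adj    : Fin n → Fin n → Bool
    sym    : ∀ u v → adj u v ≡ adj v u
    irrefl : ∀ v → adj v v ≡ false
open Graph public

InducedCopy : ∀ {m n} → Graph m → Graph n → Set
InducedCopy {m} {n} H G =
  Σ (Fin m → Fin n) λ f → Injective _≡_ _≡_ f × (∀ i j → adj G (f i) (f j) ≡ adj H i j)

Free : ∀ {m n} → Graph m → Graph n → Set
Free H G = ¬ InducedCopy H G

-- P2 ∪ P4 on vertices 0..5 : edges 0-1, 2-3, 3-4, 4-5.
p2p4Adj : Fin 6 → Fin 6 → Bool
p2p4Adj zero (suc zero) = true
p2p4Adj (suc zero) zero = true
p2p4Adj (suc (suc zero)) (suc (suc (suc zero))) = true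
p2p4Adj (suc (suc (suc zero))) (suc (suc zero)) = true
p2p4Adj (suc (suc (suc zero))) (suc (suc (suc (suc zero)))) = true
p2p4Adj (suc (suc (suc (suc zero)))) (suc (suc (suc zero))) = true
p2p4Adj (suc (suc (suc (suc zero)))) (suc (suc (suc (suc (suc zero))))) = true
p2p4Adj (suc (suc (suc (suc (suc zero))))) (suc (suc (suc (suc zero)))) = true
p2p4Adj _ _ = false

P2∪P4 : Graph 6
P2∪P4 = record { adj = p2p4Adj ; sym = s ; irrefl = i }
  where
  s : ∀ u v → p2p4Adj u v ≡ p2p4Adj v u
  s zero zero = _≡_.refl
  s zero (suc zero) = _≡_.refl
  s zero (suc (suc zero)) = _≡_.refl
  s zero (suc (suc (suc zero))) = _≡_.refl
  s zero (suc (suc (suc (suc zero)))) = _≡_.refl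
  s zero (suc (suc (suc (suc (suc zero))))) = _≡_.refl
  s (suc zero) zero = _≡_.refl
  s (suc zero) (suc zero) = _≡_.refl
  s (suc zero) (suc (suc zero)) = _≡_.refl
  s (suc zero) (suc (suc (suc zero))) = _≡_.refl
  s (suc zero) (suc (suc (suc (suc zero)))) = _≡_.refl
  s (suc zero) (suc (suc (suc (suc (suc zero))))) = _≡_.refl
  s (suc (suc zero)) zero = _≡_.refl
  s (suc (suc zero)) (suc zero) = _≡_.refl
  s (suc (suc zero)) (suc (suc zero)) = _≡_.refl
  s (suc (suc zero)) (suc (suc (suc zero))) = _≡_.refl
  s (suc (suc zero)) (suc (suc (suc (suc zero)))) = _≡_.refl
  s (suc (suc zero)) (suc (suc (suc (suc (suc zero))))) = _≡_.refl
  s (suc (suc (suc zero))) zero = _≡_.refl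
  s (suc (suc (suc zero))) (suc zero) = _≡_.refl
  s (suc (suc (suc zero))) (suc (suc zero)) = _≡_.refl
  s (suc (suc (suc zero))) (suc (suc (suc zero))) = _≡_.refl
  s (suc (suc (suc zero))) (suc (suc (suc (suc zero)))) = _≡_.refl
  s (suc (suc (suc zero))) (suc (suc (suc (suc (suc zero))))) = _≡_.refl
  s (suc (suc (suc (suc zero)))) zero = _≡_.refl
  s (suc (suc (suc (suc zero)))) (suc zero) = _≡_.refl
  s (suc (suc (suc (suc zero)))) (suc (suc zero)) = _≡_.refl
  s (suc (suc (suc (suc zero)))) (suc (suc (suc zero))) = _≡_.refl
  s (suc (suc (suc (suc zero)))) (suc (suc (suc (suc zero)))) = _≡_.refl
  s (suc (suc (suc (suc zero)))) (suc (suc (suc (suc (suc zero))))) = _≡_.refl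
  s (suc (suc (suc (suc (suc zero))))) zero = _≡_.refl
  s (suc (suc (suc (suc (suc zero))))) (suc zero) = _≡_.refl
  s (suc (suc (suc (suc (suc zero))))) (suc (suc zero)) = _≡_.refl
  s (suc (suc (suc (suc (suc zero))))) (suc (suc (suc zero))) = _≡_.refl
  s (suc (suc (suc (suc (suc zero))))) (suc (suc (suc (suc zero)))) = _≡_.refl
  s (suc (suc (suc (suc (suc zero))))) (suc (suc (suc (suc (suc zero))))) = _≡_.refl
  i : ∀ v → p2p4Adj v v ≡ false
  i zero = _≡_.refl
  i (suc zero) = _≡_.refl
  i (suc (suc zero)) = _≡_.refl
  i (suc (suc (suc zero))) = _≡_.refl
  i (suc (suc (suc (suc zero)))) = _≡_.refl
  i (suc (suc (suc (suc (suc zero))))) = _≡_.refl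

-- Diamond = K4 minus the edge {2,3}: vertices 0..3, all pairs adjacent except 2-3.
diamondAdj : Fin 4 → Fin 4 → Bool
diamondAdj zero zero = false
diamondAdj (suc zero) (suc zero) = false
diamondAdj (suc (suc zero)) (suc (suc zero)) = false
diamondAdj (suc (suc (suc zero))) (suc (suc (suc zero))) = false
diamondAdj (suc (suc zero)) (suc (suc (suc zero))) = false
diamondAdj (suc (suc (suc zero))) (suc (suc zero)) = false
diamondAdj _ _ = true

Diamond : Graph 4
Diamond = record { adj = diamondAdj ; sym = s ; irrefl = i }
  where
  s : ∀ u v → diamondAdj u v ≡ diamondAdj v u
  s zero zero = _≡_.refl
  s zero (suc zero) = _≡_.refl
  s zero (suc (suc zero)) = _≡_.refl
  s zero (suc (suc (suc zero))) = _≡_.refl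
  s (suc zero) zero = _≡_.refl
  s (suc zero) (suc zero) = _≡_.refl
  s (suc zero) (suc (suc zero)) = _≡_.refl
  s (suc zero) (suc (suc (suc zero))) = _≡_.refl
  s (suc (suc zero)) zero = _≡_.refl
  s (suc (suc zero)) (suc zero) = _≡_.refl
  s (suc (suc zero)) (suc (suc zero)) = _≡_.refl
  s (suc (suc zero)) (suc (suc (suc zero))) = _≡_.refl
  s (suc (suc (suc zero))) zero = _≡_.refl
  s (suc (suc (suc zero))) (suc zero) = _≡_.refl
  s (suc (suc (suc zero))) (suc (suc zero)) = _≡_.refl
  s (suc (suc (suc zero))) (suc (suc (suc zero))) = _≡_.refl
  i : ∀ v → diamondAdj v v ≡ false
  i zero = _≡_.refl
  i (suc zero) = _≡_.refl
  i (suc (suc zero)) = _≡_.refl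
  i (suc (suc (suc zero))) = _≡_.refl

IsClique : ∀ {n} → Graph n → Subset n → Set
IsClique G S = ∀ u v → u ∈ S → v ∈ S → u ≢ v → adj G u v ≡ true

_⊆ᵥ_ : ∀ {n} → Subset n → Subset n → Set
S ⊆ᵥ U = ∀ v → v ∈ S → v ∈ U

CliqueNumberOn : ∀ {n} → Graph n → Subset n → ℕ → Set
CliqueNumberOn G U k =
  (Σ (Subset _) λ S → S ⊆ᵥ U × IsClique G S × ∣ S ∣ ≡ k)
  × (∀ S → S ⊆ᵥ U → IsClique G S → ∣ S ∣ ≤ k)

CliqueNumber : ∀ {n} → Graph n → ℕ → Set
CliqueNumber G k = CliqueNumberOn G ⊤ k

IsMaximumClique : ∀ {n} → Graph n → Subset n → Set
IsMaximumClique G A = IsClique G A × (∀ S → IsClique G S → ∣ S ∣ ≤ ∣ A ∣)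

ProperColouring : ∀ {n} → Graph n → (c : ℕ) → (Fin n → Fin c) → Set
ProperColouring G c f = ∀ u v → adj G u v ≡ true → f u ≢ f v

χ≤ : ∀ {n} → Graph n → ℕ → Set
χ≤ {n} G c = Σ (Fin n → Fin c) λ f → ProperColouring G c f

-- A maximum clique A = {x, y, z} is a triangle, and a vertex outside A has at most one neighbour in
-- A, since two neighbours would span a K4 or an induced diamond with A. Hence every vertex of
-- H = G − A misses both ends of one of the edges xy, yz, zx. The vertices of H missing both ends of
-- an edge e induce a triangle-free graph (ω(H) ≤ 2) with no induced P4 (a P4 there together with e
-- is an induced P2 ∪ P4), and such a graph is bipartite because its components have diameter at most
-- two. Adding one end of e, which has no neighbour in this part, yields three bipartite sets covering
-- G, so six colours suffice.
module Submission where

open import Level using (Level; 0ℓ)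
open import Defs
open import Data.Bool.Base using (Bool; true; false)
import Data.Bool.Properties as Bool
open import Data.Empty using (⊥; ⊥-elim)
open import Data.Fin.Base using (Fin; zero; suc; fromℕ<; inject; combine)
  renaming (_≤_ to _≤ᶠ_; _<_ to _<ᶠ_)
open import Data.Fin.Patterns using (0F; 1F; 2F)
open import Data.Fin.Properties
  using (¬∀⟶∃¬-smallest; toℕ-injective; toℕ-inject; toℕ-fromℕ<; ≤-antisym; <-cmp; suc-injective;
         any?; combine-injective; 2↔Bool)
  renaming (_≟_ to _≟ᶠ_)
open import Data.Fin.Subset using (Subset; _∈_; _∉_; ∁; ∣_∣; ⁅_⁆; ⋃; _-_; ⊤; inside; outside)
open import Data.Fin.Subset.Properties
  using (_∈?_; ∈⊤; ∉⊥; x∈⁅x⁆; x∈⁅y⁆⇒x≡y; x∈p∪q⁺; x∈p∪q⁻; x∉p⇒x∈∁p; x∈p∧x≢y⇒x∈p-y; x∈p⇒∣p-x∣<∣p∣)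
open import Data.List.Base as List using (List; []; _∷_; length)
open import Data.List.Relation.Unary.All as Allₗ using ([]; _∷_)
open import Data.List.Relation.Unary.AllPairs as AllPairsₗ using ([]; _∷_)
open import Data.List.Relation.Unary.Any as Any using ()
open import Data.List.Membership.Propositional using () renaming (_∈_ to _∈ₗ_)
import Data.List.Relation.Unary.Unique.Propositional as Uniqueₗ
open import Data.Nat.Base as ℕ using (ℕ; zero; suc; _≤_; _*_; s≤s; z≤n)
import Data.Nat.Properties as ℕ
open import Data.Product using (Σ; ∃; _×_; _,_; proj₁; proj₂)
open import Data.Sum using (_⊎_; inj₁; inj₂)
open import Data.Vec.Base as Vec using (Vec; _∷_; []; lookup; tabulate; here; there)
open import Data.Vec.Relation.Unary.All as Allᵥ using ([]; _∷_)
import Data.Vec.Relation.Unary.All.Properties as Allᵥ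
open import Data.Vec.Relation.Unary.AllPairs as AllPairsᵥ using ([]; _∷_)
import Data.Vec.Relation.Unary.Unique.Propositional as Uniqueᵥ
import Data.Vec.Relation.Unary.Unique.Propositional.Properties as Uniqueᵥ
open import Function using (_∘_; id)
open import Function.Bundles using (Injection)
open import Function.Properties.Inverse using (↔-sym; Inverse⇒Injection)
open import Relation.Binary.Core using (Rel)
open import Relation.Binary.Definitions using (Symmetric; tri<; tri≈; tri>)
open import Relation.Binary.PropositionalEquality as ≡ using (_≡_; _≢_; refl; subst; ≢-sym)
open import Relation.Nullary using (¬_; yes; no; ¬?; contradiction)
open import Relation.Nullary.Decidable using (decidable-stable; _×-dec_; _⊎-dec_)
open import Relation.Unary using (Pred; Decidable)

private
  variable
    a ℓ : Level
    A : Set a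
    k m n : ℕ

∈-⋃⁅⁆⁺ : ∀ {v : Fin n} {xs} → v ∈ₗ xs → v ∈ ⋃ (List.map ⁅_⁆ xs)
∈-⋃⁅⁆⁺ (Any.here refl) = x∈p∪q⁺ (inj₁ (x∈⁅x⁆ _))
∈-⋃⁅⁆⁺ (Any.there v∈)  = x∈p∪q⁺ (inj₂ (∈-⋃⁅⁆⁺ v∈))

∈-⋃⁅⁆⁻ : ∀ {v : Fin n} xs → v ∈ ⋃ (List.map ⁅_⁆ xs) → v ∈ₗ xs
∈-⋃⁅⁆⁻ []       v∈ = contradiction v∈ ∉⊥
∈-⋃⁅⁆⁻ (x ∷ xs) v∈ with x∈p∪q⁻ ⁅ x ⁆ _ v∈
... | inj₁ v∈⁅x⁆ = Any.here (x∈⁅y⁆⇒x≡y x v∈⁅x⁆)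
... | inj₂ v∈xs  = Any.there (∈-⋃⁅⁆⁻ xs v∈xs)

unique-members-length≤ : ∀ {p : Subset n} {xs} → Uniqueₗ.Unique xs → Allₗ.All (_∈ p) xs →
                         length xs ≤ ∣ p ∣
unique-members-length≤ []           []           = z≤n
unique-members-length≤ {p = p} {x ∷ xs} (x≢xs ∷ xs!) (x∈p ∷ xs∈p) =
  ℕ.≤-trans (s≤s (unique-members-length≤ xs! xs∈p-x)) (x∈p⇒∣p-x∣<∣p∣ x∈p)
  where
  xs∈p-x : Allₗ.All (_∈ p - x) xs
  xs∈p-x = Allₗ.zipWith (λ (y∈p , x≢y) → x∈p∧x≢y⇒x∈p-y y∈p (≢-sym x≢y)) (xs∈p , x≢xs)

distinct-members : ∀ m (p : Subset n) → m ≤ ∣ p ∣ →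
                   Σ (Vec (Fin n) m) λ xs → Uniqueᵥ.Unique xs × Allᵥ.All (_∈ p) xs
distinct-members zero    p             _     = [] , [] , []
distinct-members (suc m) (outside ∷ p) m≤∣p∣ with distinct-members (suc m) p m≤∣p∣
... | xs , xs! , xs∈p =
  Vec.map suc xs , Uniqueᵥ.map⁺ suc-injective xs! , Allᵥ.map⁺ (Allᵥ.map there xs∈p)
distinct-members (suc m) (inside ∷ p) (s≤s m≤∣p∣) with distinct-members m p m≤∣p∣
... | xs , xs! , xs∈p =
  zero ∷ Vec.map suc xs ,
  Allᵥ.map⁺ (Allᵥ.universal (λ _ ()) xs) ∷ Uniqueᵥ.map⁺ suc-injective xs! ,
  here ∷ Allᵥ.map⁺ (Allᵥ.map there xs∈p)

pairwise-∈ : ∀ {R : Rel A ℓ} {xs a b} → Symmetric R → AllPairsₗ.AllPairs R xs →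
             a ∈ₗ xs → b ∈ₗ xs → a ≢ b → R a b
pairwise-∈ _   (_ ∷ _)    (Any.here refl) (Any.here refl) a≢b = contradiction refl a≢b
pairwise-∈ _   (Rx ∷ _)   (Any.here refl) (Any.there b∈)  _   = Allₗ.lookup Rx b∈
pairwise-∈ sym (Rx ∷ _)   (Any.there a∈)  (Any.here refl) _   = sym (Allₗ.lookup Rx a∈)
pairwise-∈ sym (_ ∷ rest) (Any.there a∈)  (Any.there b∈)  a≢b = pairwise-∈ sym rest a∈ b∈ a≢b

tabulate⁻-< : ∀ {R : Rel A ℓ} {f : Fin m → A} → AllPairsᵥ.AllPairs R (tabulate f) →
              ∀ {i j} → i <ᶠ j → R (f i) (f j)
tabulate⁻-< (Rf₀ ∷ _)  {zero}  {suc j} _         = Allᵥ.tabulate⁻ Rf₀ j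
tabulate⁻-< (_ ∷ rest) {suc i} {suc j} (s≤s i<j) = tabulate⁻-< rest i<j
tabulate⁻-< _          {zero}  {zero}  ()
tabulate⁻-< _          {suc _} {zero}  ()

Least : Pred (Fin n) ℓ → Pred (Fin n) ℓ
Least P i = P i × (∀ {j} → P j → i ≤ᶠ j)

inject-fromℕ< : ∀ {i j : Fin n} (j<i : j <ᶠ i) → inject (fromℕ< j<i) ≡ j
inject-fromℕ< j<i = toℕ-injective (≡.trans (toℕ-inject (fromℕ< j<i)) (toℕ-fromℕ< j<i))

least : ∀ {P : Pred (Fin n) ℓ} → Decidable P → ∃ P → ∃ (Least P)
least {n} {P = P} P? (i , Pi) with ¬∀⟶∃¬-smallest n (¬_ ∘ P) (¬? ∘ P?) (λ ∀¬P → ∀¬P i Pi)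
... | m , ¬¬Pm , below-m =
  m , decidable-stable (P? m) ¬¬Pm ,
  λ Pj → ℕ.≮⇒≥ λ j<m → below-m (fromℕ< j<m) (subst P (≡.sym (inject-fromℕ< j<m)) Pj)

least-unique : ∀ {P Q : Pred (Fin n) ℓ} → (∀ {i} → P i → Q i) → (∀ {i} → Q i → P i) →
               ∀ {i j} → Least P i → Least Q j → i ≡ j
least-unique P⇒Q Q⇒P (Pi , i-least) (Qj , j-least) = ≤-antisym (i-least (Q⇒P Qj)) (j-least (P⇒Q Pi))

module _ {n} (G : Graph n) where

  private
    variable
      p q r s u v w x y z : Fin n

  Edge NonEdge : Fin n → Fin n → Set
  Edge    u v = adj G u v ≡ true
  NonEdge u v = adj G u v ≡ false

  adj-sym : ∀ {b} → adj G u v ≡ b → adj G v u ≡ b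
  adj-sym {u} {v} uv = ≡.trans (sym G v u) uv

  edge-sym : Symmetric Edge
  edge-sym = adj-sym

  edge⇒¬nonEdge : Edge u v → ¬ NonEdge u v
  edge⇒¬nonEdge uv ¬uv = contradiction (≡.trans (≡.sym uv) ¬uv) λ ()

  edge⇒≢ : Edge u v → u ≢ v
  edge⇒≢ {u} uv refl = edge⇒¬nonEdge uv (irrefl G u)

  separated : Edge u w → NonEdge v w → u ≢ v
  separated uw vw refl = edge⇒¬nonEdge uw vw

  CliqueBoundOn : Subset n → ℕ → Set
  CliqueBoundOn U k = ∀ S → S ⊆ᵥ U → IsClique G S → ∣ S ∣ ≤ k

  Triangle : Fin n → Fin n → Fin n → Set
  Triangle p q r = Edge p q × Edge q r × Edge p r

  InducedP4 : Fin n → Fin n → Fin n → Fin n → Set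
  InducedP4 p q r s = Edge p q × Edge q r × Edge r s × NonEdge p r × NonEdge q s × NonEdge p s

  TriangleFreeOn : Pred (Fin n) ℓ → Set ℓ
  TriangleFreeOn X = ∀ {p q r} → X p → X q → X r → ¬ Triangle p q r

  P4FreeOn : Pred (Fin n) ℓ → Set ℓ
  P4FreeOn X = ∀ {p q r s} → X p → X q → X r → X s → ¬ InducedP4 p q r s

  TwoColouringOn : Pred (Fin n) ℓ → Set ℓ
  TwoColouringOn X = Σ (Fin n → Bool) λ half → ∀ {u v} → X u → X v → Edge u v → half u ≢ half v

  pairwise-adjacent-length≤ : ∀ {U xs} → CliqueBoundOn U k → Allₗ.All (_∈ U) xs →
                              AllPairsₗ.AllPairs Edge xs → length xs ≤ k
  pairwise-adjacent-length≤ {U = U} {xs} ω≤k xs∈U xs-adjacent =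
    ℕ.≤-trans (unique-members-length≤ (AllPairsₗ.map edge⇒≢ xs-adjacent) (Allₗ.tabulate ∈-⋃⁅⁆⁺))
              (ω≤k (⋃ (List.map ⁅_⁆ xs)) spanned⊆U spanned-clique)
    where
    spanned⊆U : ⋃ (List.map ⁅_⁆ xs) ⊆ᵥ U
    spanned⊆U v v∈ = Allₗ.lookup xs∈U (∈-⋃⁅⁆⁻ xs v∈)
    spanned-clique : IsClique G (⋃ (List.map ⁅_⁆ xs))
    spanned-clique u v u∈ v∈ = pairwise-∈ edge-sym xs-adjacent (∈-⋃⁅⁆⁻ xs u∈) (∈-⋃⁅⁆⁻ xs v∈)

  no-K4 : CliqueBoundOn ⊤ 3 → ¬ AllPairsₗ.AllPairs Edge (p ∷ q ∷ r ∷ s ∷ [])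
  no-K4 ω≤3 K4 = ℕ.<-irrefl refl (pairwise-adjacent-length≤ ω≤3 (Allₗ.universal (λ _ → ∈⊤) _) K4)

  Faithful : Graph m → Rel (Fin m × Fin n) 0ℓ
  Faithful H (i , u) (j , v) = u ≢ v × adj G u v ≡ adj H i j

  inducedCopy : ∀ {H : Graph m} (f : Fin m → Fin n) →
                AllPairsᵥ.AllPairs (Faithful H) (tabulate (λ i → i , f i)) → InducedCopy H G
  inducedCopy {H = H} f table = f , injective , preserves
    where
    faithful : ∀ {i j} → i <ᶠ j → Faithful H (i , f i) (j , f j)
    faithful = tabulate⁻-< table

    injective : ∀ {i j} → f i ≡ f j → i ≡ j
    injective {i} {j} fi≡fj with <-cmp i j
    ... | tri< i<j _ _ = contradiction fi≡fj (proj₁ (faithful i<j))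
    ... | tri≈ _ i≡j _ = i≡j
    ... | tri> _ _ j<i = contradiction (≡.sym fi≡fj) (proj₁ (faithful j<i))

    preserves : ∀ i j → adj G (f i) (f j) ≡ adj H i j
    preserves i j with <-cmp i j
    ... | tri< i<j _ _  = proj₂ (faithful i<j)
    ... | tri≈ _ refl _ = ≡.trans (irrefl G (f i)) (≡.sym (irrefl H i))
    ... | tri> _ _ j<i  = ≡.trans (sym G (f i) (f j)) (≡.trans (proj₂ (faithful j<i)) (sym H j i))

  diamondCopy : Edge w x → Edge w y → Edge w z → Edge x y → Edge x z → NonEdge y z → y ≢ z →
                InducedCopy Diamond G
  diamondCopy {w} {x} {y} {z} wx wy wz xy xz yz y≢z =
    inducedCopy {H = Diamond} (lookup (w ∷ x ∷ y ∷ z ∷ []))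
    ( ((edge⇒≢ wx , wx) ∷ (edge⇒≢ wy , wy) ∷ (edge⇒≢ wz , wz) ∷ [])
    ∷ ((edge⇒≢ xy , xy) ∷ (edge⇒≢ xz , xz) ∷ [])
    ∷ ((y≢z , yz) ∷ [])
    ∷ [] ∷ [])

  P4FreeOn-beside-edge : ∀ {X : Pred (Fin n) ℓ} → Free P2∪P4 G → Edge x y →
                         (∀ {v} → X v → NonEdge v x × NonEdge v y) → P4FreeOn X
  P4FreeOn-beside-edge {x = x} {y = y} {X = X} P2∪P4-free xy misses {p} {q} {r} {s} Xp Xq Xr Xs
                       (pq , qr , rs , pr , qs , ps) =
    P2∪P4-free (inducedCopy {H = P2∪P4} (lookup (x ∷ y ∷ p ∷ q ∷ r ∷ s ∷ []))
      ( ((edge⇒≢ xy , xy) ∷ from-x Xp ∷ from-x Xq ∷ from-x Xr ∷ from-x Xs ∷ [])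
      ∷ (from-y Xp ∷ from-y Xq ∷ from-y Xr ∷ from-y Xs ∷ [])
      ∷ ((edge⇒≢ pq , pq) ∷ (≢-sym (separated rs ps) , pr) ∷ (separated pq (adj-sym qs) , ps) ∷ [])
      ∷ ((edge⇒≢ qr , qr) ∷ (separated (adj-sym pq) (adj-sym ps) , qs) ∷ [])
      ∷ ((edge⇒≢ rs , rs) ∷ [])
      ∷ [] ∷ []))
    where
    from-x : ∀ {v} → X v → x ≢ v × NonEdge x v
    from-x Xv = let vx , vy = misses Xv in separated xy vy , adj-sym vx
    from-y : ∀ {v} → X v → y ≢ v × NonEdge y v
    from-y Xv = let vx , vy = misses Xv in separated (adj-sym xy) vx , adj-sym vy

  at-most-one-neighbour-in-triangle : Free Diamond G → CliqueBoundOn ⊤ 3 →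
    Edge x y → Edge x z → Edge y z → v ≢ z → Edge v x → Edge v y → ⊥
  at-most-one-neighbour-in-triangle {x} {y} {z} {v} diamond-free ω≤3 xy xz yz v≢z vx vy
    with adj G v z in vz
  ... | true  = no-K4 ω≤3
    ((xy ∷ xz ∷ adj-sym vx ∷ []) ∷ (yz ∷ adj-sym vy ∷ []) ∷ (adj-sym vz ∷ []) ∷ [] ∷ [])
  ... | false = diamond-free
    (diamondCopy xy xz (adj-sym vx) yz (adj-sym vy) (adj-sym vz) (≢-sym v≢z))

  χ≤-by-classes : (class : Fin n → Fin k) (half : Fin n → Bool) →
                  (∀ {u v} → Edge u v → class u ≡ class v → half u ≢ half v) → χ≤ G (k * 2)
  χ≤-by-classes {k} class half split = colour , proper
    where
    bit : Injection (≡.setoid Bool) (≡.setoid (Fin 2))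
    bit = Inverse⇒Injection (↔-sym 2↔Bool)

    colour : Fin n → Fin (k * 2)
    colour v = combine (class v) (Injection.to bit (half v))

    proper : ProperColouring G (k * 2) colour
    proper u v uv same-colour =
      let same-class , same-bit = combine-injective (class u) _ (class v) _ same-colour
      in split uv same-class (Injection.injective bit same-bit)

  -- A triangle-free, P4-free graph is bipartite: any three-edge walk closes up into an edge, so a
  -- component has diameter at most two, and a vertex is coloured by adjacency to the least vertex of
  -- its component.
  module _ {X : Pred (Fin n) ℓ} (X? : Decidable X)
           (triangle-free : TriangleFreeOn X) (P4-free : P4FreeOn X) where

    walk₃-closes : X p → X q → X r → X s → Edge p q → Edge q r → Edge r s → Edge p s
    walk₃-closes {p} {q} {r} {s} Xp Xq Xr Xs pq qr rs
      with adj G p r in pr | adj G q s in qs | adj G p s in ps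
    ... | true  | _     | _     = ⊥-elim (triangle-free Xp Xq Xr (pq , qr , pr))
    ... | false | true  | _     = ⊥-elim (triangle-free Xq Xr Xs (qr , rs , qs))
    ... | false | false | true  = refl
    ... | false | false | false = ⊥-elim (P4-free Xp Xq Xr Xs (pq , qr , rs , pr , qs , ps))

    Near : Fin n → Pred (Fin n) ℓ
    Near v w = X w × (v ≡ w ⊎ Edge v w ⊎ ∃ λ x → X x × Edge v x × Edge x w)

    near? : ∀ v → Decidable (Near v)
    near? v w =
      X? w ×-dec (v ≟ᶠ w ⊎-dec adj G v w Bool.≟ true
                        ⊎-dec any? λ x → X? x ×-dec adj G v x Bool.≟ true ×-dec adj G x w Bool.≟ true)

    near-refl : X v → Near v v
    near-refl Xv = Xv , inj₁ refl

    near-step : X u → X v → Edge u v → Near u w → Near v w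
    near-step Xu Xv uv (Xw , inj₁ refl)                      = Xu , inj₂ (inj₁ (edge-sym uv))
    near-step Xu Xv uv (Xw , inj₂ (inj₁ uw))                 =
      Xw , inj₂ (inj₂ (_ , Xu , edge-sym uv , uw))
    near-step Xu Xv uv (Xw , inj₂ (inj₂ (x , Xx , ux , xw))) =
      Xw , inj₂ (inj₁ (walk₃-closes Xv Xu Xx Xw (edge-sym uv) ux xw))

    root : X v → ∃ (Least (Near v))
    root Xv = least (near? _) (_ , near-refl Xv)

    neighbours-share-root : (Xu : X u) (Xv : X v) → Edge u v → proj₁ (root Xu) ≡ proj₁ (root Xv)
    neighbours-share-root Xu Xv uv =
      least-unique (near-step Xu Xv uv) (near-step Xv Xu (edge-sym uv))
                   (proj₂ (root Xu)) (proj₂ (root Xv))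

    near-neighbour : X u → X v → Edge u v → Near u w → NonEdge u w → Edge v w
    near-neighbour Xu Xv uv (Xw , inj₁ refl)                      _   = edge-sym uv
    near-neighbour Xu Xv uv (Xw , inj₂ (inj₁ uw))                 ¬uw = ⊥-elim (edge⇒¬nonEdge uw ¬uw)
    near-neighbour Xu Xv uv (Xw , inj₂ (inj₂ (x , Xx , ux , xw))) _   =
      walk₃-closes Xv Xu Xx Xw (edge-sym uv) ux xw

    neighbours-disagree-on-near : X u → X v → Edge u v → Near u w → adj G u w ≢ adj G v w
    neighbours-disagree-on-near {u} {v} {w} Xu Xv uv u~w same with adj G v w in vw
    ... | true  = triangle-free Xu Xv (proj₁ u~w) (uv , vw , same)
    ... | false = edge⇒¬nonEdge (near-neighbour Xu Xv uv u~w same) vw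

    root-side : Fin n → Bool
    root-side v with X? v
    ... | yes Xv = adj G v (proj₁ (root Xv))
    ... | no  _  = false

    root-side-≡ : (Xv : X v) → root-side v ≡ adj G v (proj₁ (root Xv))
    root-side-≡ {v} Xv with X? v
    ... | yes Xv′ = ≡.cong (adj G v) (least-unique id id (proj₂ (root Xv′)) (proj₂ (root Xv)))
    ... | no ¬Xv  = contradiction Xv ¬Xv

    twoColouring : TwoColouringOn X
    twoColouring = root-side , separates
      where
      separates : ∀ {u v} → X u → X v → Edge u v → root-side u ≢ root-side v
      separates {u} {v} Xu Xv uv sides≡ =
        neighbours-disagree-on-near Xu Xv uv (proj₁ (proj₂ (root Xu))) (begin
          adj G u (proj₁ (root Xu)) ≡⟨ ≡.sym (root-side-≡ Xu) ⟩
          root-side u               ≡⟨ sides≡ ⟩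
          root-side v               ≡⟨ root-side-≡ Xv ⟩
          adj G v (proj₁ (root Xv)) ≡⟨ ≡.cong (adj G v) (neighbours-share-root Xu Xv uv) ⟨
          adj G v (proj₁ (root Xu)) ∎)
        where open ≡.≡-Reasoning

module SixColouring {n} (G : Graph n) (P2∪P4-free : Free P2∪P4 G) (diamond-free : Free Diamond G)
  (ω≤3 : CliqueBoundOn G ⊤ 3) {A : Subset n} (A-clique : IsClique G A)
  (ω[G-A]≤2 : CliqueBoundOn G (∁ A) 2)
  {x y z : Fin n} (x∈A : x ∈ A) (y∈A : y ∈ A) (z∈A : z ∈ A) (x≢y : x ≢ y) (x≢z : x ≢ z) (y≢z : y ≢ z)
  where

  private
    variable
      u v : Fin n

  xy : Edge G x y
  xy = A-clique _ _ x∈A y∈A x≢y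
  xz : Edge G x z
  xz = A-clique _ _ x∈A z∈A x≢z
  yz : Edge G y z
  yz = A-clique _ _ y∈A z∈A y≢z

  corner : Fin 3 → Fin n
  corner = lookup (x ∷ y ∷ z ∷ [])

  next : Fin 3 → Fin 3
  next 0F = 1F
  next 1F = 2F
  next 2F = 0F

  corner-edge : ∀ i → Edge G (corner i) (corner (next i))
  corner-edge 0F = xy
  corner-edge 1F = yz
  corner-edge 2F = adj-sym G xz

  ∉A⇒≢ : v ∉ A → u ∈ A → v ≢ u
  ∉A⇒≢ v∉A u∈A refl = v∉A u∈A

  A-corners : v ∈ A → ∃ λ i → v ≡ corner i
  A-corners {v} v∈A with v ≟ᶠ x | v ≟ᶠ y | v ≟ᶠ z
  ... | yes v≡x | _       | _       = 0F , v≡x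
  ... | no _    | yes v≡y | _       = 1F , v≡y
  ... | no _    | no _    | yes v≡z = 2F , v≡z
  ... | no v≢x  | no v≢y  | no v≢z  = ⊥-elim (no-K4 G ω≤3
    ((xy ∷ xz ∷ to-v x∈A v≢x ∷ []) ∷ (yz ∷ to-v y∈A v≢y ∷ []) ∷ (to-v z∈A v≢z ∷ []) ∷ [] ∷ []))
    where
    to-v : u ∈ A → v ≢ u → Edge G u v
    to-v u∈A v≢u = A-clique _ _ u∈A v∈A (≢-sym v≢u)

  Part : Fin 3 → Pred (Fin n) 0ℓ
  Part i v = v ∉ A × NonEdge G v (corner i) × NonEdge G v (corner (next i))

  part? : ∀ i → Decidable (Part i)
  part? i v =
    ¬? (v ∈? A) ×-dec adj G v (corner i) Bool.≟ false ×-dec adj G v (corner (next i)) Bool.≟ false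

  one-neighbour : ∀ {p q r} → Edge G p q → Edge G p r → Edge G q r →
                  v ≢ r → Edge G v p → Edge G v q → ⊥
  one-neighbour = at-most-one-neighbour-in-triangle G diamond-free ω≤3

  misses-two-corners : v ∉ A → ∃ λ i → Part i v
  misses-two-corners {v} v∉A with adj G v x in vx | adj G v y in vy | adj G v z in vz
  ... | true  | true  | _     = ⊥-elim (one-neighbour xy xz yz (∉A⇒≢ v∉A z∈A) vx vy)
  ... | true  | false | true  = ⊥-elim (one-neighbour xz xy (adj-sym G yz) (∉A⇒≢ v∉A y∈A) vx vz)
  ... | false | true  | true  =
    ⊥-elim (one-neighbour yz (adj-sym G xy) (adj-sym G xz) (∉A⇒≢ v∉A x∈A) vy vz)
  ... | true  | false | false = 1F , v∉A , vy , vz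
  ... | false | true  | false = 2F , v∉A , vz , vx
  ... | false | false | _     = 0F , v∉A , vx , vy

  part-triangle-free : ∀ i → TriangleFreeOn G (Part i)
  part-triangle-free i (p∉A , _) (q∉A , _) (r∉A , _) (pq , qr , pr) =
    ℕ.<-irrefl refl (pairwise-adjacent-length≤ G ω[G-A]≤2
      (x∉p⇒x∈∁p p∉A ∷ x∉p⇒x∈∁p q∉A ∷ x∉p⇒x∈∁p r∉A ∷ []) ((pq ∷ pr ∷ []) ∷ (qr ∷ []) ∷ [] ∷ []))

  part-colouring : ∀ i → TwoColouringOn G (Part i)
  part-colouring i = twoColouring G (part? i) (part-triangle-free i)
                                   (P4FreeOn-beside-edge G P2∪P4-free (corner-edge i) proj₂)

  -- Corner i is coloured along with part i, which contains none of its neighbours.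
  data Place (v : Fin n) : Set where
    at-corner : ∀ i → v ≡ corner i → Place v
    in-part   : ∀ i → Part i v → Place v

  place : ∀ v → Place v
  place v with v ∈? A
  ... | yes v∈A = let i , v≡corner = A-corners v∈A in at-corner i v≡corner
  ... | no  v∉A = let i , v∈part = misses-two-corners v∉A in in-part i v∈part

  class : Place v → Fin 3
  class (at-corner i _) = i
  class (in-part i _)   = i

  half : Place v → Bool
  half     (at-corner _ _) = false
  half {v} (in-part i _)   = proj₁ (part-colouring i) v

  place-separates : (pu : Place u) (pv : Place v) → Edge G u v →
                    class pu ≡ class pv → half pu ≢ half pv
  place-separates (at-corner i refl) (at-corner i refl)      uv refl = ⊥-elim (edge⇒≢ G uv refl)
  place-separates (at-corner i refl) (in-part i (_ , vu , _)) uv refl =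
    ⊥-elim (edge⇒¬nonEdge G (adj-sym G uv) vu)
  place-separates (in-part i (_ , ¬uv , _)) (at-corner i refl) uv refl = ⊥-elim (edge⇒¬nonEdge G uv ¬uv)
  place-separates (in-part i u∈part) (in-part i v∈part)      uv refl =
    proj₂ (part-colouring i) u∈part v∈part uv

  χ≤6 : χ≤ G 6
  χ≤6 = χ≤-by-classes G (class ∘ place) (half ∘ place)
                        λ {u} {v} uv → place-separates (place u) (place v) uv

lemma2p4 : ∀ {n} (G : Graph n) → Free P2∪P4 G → Free Diamond G → CliqueNumber G 3 →
    (A : Subset n) → IsMaximumClique G A →
    ∃ (λ (v : Fin n) → v ∈ ∁ A) →
    (k : ℕ) → CliqueNumberOn G (∁ A) k → k ≤ 2 →
    χ≤ G 6
lemma2p4 G P2∪P4-free diamond-free ((S , _ , S-clique , ∣S∣≡3) , ω≤3) A (A-clique , A-maximum) _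
         k (_ , ω[G-A]≤k) k≤2
  with distinct-members 3 A (subst (_≤ ∣ A ∣) ∣S∣≡3 (A-maximum S S-clique))
... | x ∷ y ∷ z ∷ [] , (x≢y ∷ x≢z ∷ []) ∷ (y≢z ∷ []) ∷ [] ∷ [] , x∈A ∷ y∈A ∷ z∈A ∷ [] =
  SixColouring.χ≤6 G P2∪P4-free diamond-free ω≤3 A-clique ω[G-A]≤2 x∈A y∈A z∈A x≢y x≢z y≢z
  where
  ω[G-A]≤2 : CliqueBoundOn G (∁ A) 2
  ω[G-A]≤2 T T⊆∁A T-clique = ℕ.≤-trans (ω[G-A]≤k T T⊆∁A T-clique) k≤2
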